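{- Let $m\ge 1$, $n\ge 5$ and $G=\times_m P_n$. For integers $0\le j\le m$ and $0\le i\le j$, let $t_j=j(j+1)/2$ be the $j$-th triangular number, let $r=t_j+i$, and let $v_r$ be the vertex of $G$ whose coordinates, in nondecreasing order, consist of $m-j$ entries equal to $1$, $j-i$ entries equal to $2$ and $i$ entries equal to $3$ (equivalently, $v_r$ is the $r$-th, counting from $0$, nondecreasing $m$-tuple with entries in $\{1,2,3\}$ in lexicographic order). Then: (1) $l(v_r)=\frac{1}{m+j}\left[\frac{j-i}{2(m+j)-1}-\frac{m-j}{2(m+j)+1}\right]$; (2) the number of distinct values of $l(v)$, $v\in V(G)$, is at most $\binom{m+2}{2}$, and if $m<7$ it is exactly $\binom{m+2}{2}$.
   Context: $\times_m P_n$ is the Cartesian product of $m$ copies of the path $P_n$: its vertices are the $m$-tuples $(v_1,\dots,v_m)\in\{1,\dots,n\}^m$, and two vertices are adjacent iff they differ in exactly one coordinate, and there by exactly $1$. For a vertex $v$ of positive degree, with neighborhood $N_v$, the leverage centrality is $l(v)=\frac{1}{\deg(v)}\sum_{w\in N_v}\frac{\deg(v)-\deg(w)}{\deg(v)+\deg(w)}$. -}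

module Defs where

open import Data.Bool using (Bool; true; false; _∧_; _∨_; if_then_else_)
open import Data.Nat using (ℕ; zero; suc; _+_; _*_; _∸_; _<ᵇ_; _≡ᵇ_; ∣_-_∣)
open import Data.Integer as ℤ using (ℤ; +_; _⊖_)
open import Data.Rational as ℚ using (ℚ; 0ℚ)
open import Data.List using (List; []; _∷_; [_]; map; concatMap; length; upTo; filterᵇ; foldr; deduplicate)
import Data.List as L
open import Data.Vec using (Vec; []; _∷_; zipWith; toList; tabulate)
open import Data.Fin using (Fin; toℕ)
import Data.Rational.Properties as ℚP
open import Data.Nat.ListAction using () renaming (sum to sumℕ)
open import Data.Bool.ListAction using () renaming (and to andL)

vertices : (n m : ℕ) → List (Vec ℕ m)
vertices n zero = [ [] ]
vertices n (suc m) = concatMap (λ a → map (a ∷_) (vertices n m)) (map suc (upTo n))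

countDiff : ∀ {m} → Vec ℕ m → Vec ℕ m → ℕ
countDiff v w = sumℕ (toList (zipWith (λ a b → if a ≡ᵇ b then 0 else 1) v w))

diffsByOne : ∀ {m} → Vec ℕ m → Vec ℕ m → Bool
diffsByOne v w = andL (toList (zipWith (λ a b → (a ≡ᵇ b) ∨ (∣ a - b ∣ ≡ᵇ 1)) v w))

adj : ∀ {m} → Vec ℕ m → Vec ℕ m → Bool
adj v w = (countDiff v w ≡ᵇ 1) ∧ diffsByOne v w

nbhd : (n : ℕ) {m : ℕ} → Vec ℕ m → List (Vec ℕ m)
nbhd n {m} v = filterᵇ (adj v) (vertices n m)

deg : (n : ℕ) {m : ℕ} → Vec ℕ m → ℕ
deg n v = length (nbhd n v)

-- p / d as a rational, with the (never used here) convention p / 0 = 0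
frac : ℤ → ℕ → ℚ
frac p zero = 0ℚ
frac p (suc d) = p ℚ./ suc d

sumℚ : List ℚ → ℚ
sumℚ = foldr ℚ._+_ 0ℚ

-- leverage centrality of v in ×_m P_n (the value for deg v = 0 is irrelevant)
lev : (n : ℕ) {m : ℕ} → Vec ℕ m → ℚ
lev n v = frac (+ 1) (deg n v) ℚ.*
  sumℚ (map (λ w → frac (deg n v ⊖ deg n w) (deg n v + deg n w)) (nbhd n v))

vr : (m j i : ℕ) → Vec ℕ m
vr m j i = tabulate (λ (k : Fin m) →
  if toℕ k <ᵇ (m ∸ j) then 1 else if toℕ k <ᵇ (m ∸ i) then 2 else 3)

numLevValues : (n m : ℕ) → ℕ
numLevValues n m = length (deduplicate ℚP._≟_ (map (lev n) (vertices n m)))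

module Submission where

-- For n ≥ 4, each coordinate a of a vertex v of ×_m P_n is an end (a ∈ {1, n}, path degree 1), a
-- near end (a ∈ {2, n − 1}) or interior, and deg v is the sum of the path degrees of its coordinates,
-- so deg v = 2m − e when v has e end and q near-end coordinates. A neighbour of v moves one coordinate
-- by one step, so its degree differs from D = deg v by at most one: moving an end coordinate inwards
-- contributes −1/(2D+1), moving a near-end coordinate to the end contributes 1/(2D−1), and every
-- other move contributes 0. Hence l(v) = (1/D)(q/(2D−1) − e/(2D+1)), which depends only on the pair
-- (e, q) with e + q ≤ m, i.e. on (j, i) = (m − e, m − e − q). This gives at most C(m+2, 2) values,
-- all attained by the v_r (for n ≥ 5, so that 3 is interior); for m < 7 they are pairwise distinct,
-- which is checked by evaluation.

open import Algebra.Bundles using (CommutativeMonoid)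
open import Data.Bool using (Bool; true; false; _∧_; _∨_; if_then_else_; T)
open import Data.Bool.Properties using (¬-not; ∧-commutativeMonoid)
open import Data.Empty using (⊥-elim)
open import Data.Fin using (Fin; toℕ)
open import Data.Integer as ℤ using (+_; _⊖_)
import Data.Integer.Properties as ℤ
open import Data.Integer.Tactic.RingSolver using () renaming (solve-∀ to ℤ-solve-∀)
open import Data.List using (List; []; _∷_; [_]; _++_; map; concatMap; filterᵇ; length; upTo; applyUpTo)
import Data.List.Properties as List
open import Data.List.Membership.Propositional using (_∈_; find)
open import Data.List.Membership.Propositional.Properties
  using (∈-concatMap⁻; ∈-map⁺; ∈-map⁻; ∈-filter⁻; ∈-++⁺ˡ; ∈-++⁺ʳ; ∈-++⁻; ∈-∃++;
         ∈-upTo⁺; ∈-upTo⁻; ∈-deduplicate⁺; ∈-deduplicate⁻)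
open import Data.List.Relation.Binary.Permutation.Propositional
  using (_↭_; ↭-refl; ↭-reflexive; ↭-trans; ↭⇒↭ₛ; module PermutationReasoning)
import Data.List.Relation.Binary.Permutation.Propositional.Properties as ↭
import Data.List.Relation.Binary.Permutation.Setoid.Properties as Perm
open import Data.List.Relation.Binary.Subset.Propositional using (_⊆_)
open import Data.List.Relation.Unary.All as All using (All; []; _∷_)
open import Data.List.Relation.Unary.AllPairs using ([]; _∷_)
open import Data.List.Relation.Unary.Any using (here; there)
open import Data.List.Relation.Unary.Unique.Propositional using (Unique)
open import Data.Nat using (ℕ; zero; suc; _+_; _*_; _∸_; _≡ᵇ_; _<ᵇ_; ∣_-_∣; _≤_; _<_; s≤s; z≤n;
                            compare; less; equal; greater)
import Data.Nat.Properties as ℕ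
open import Data.Nat.Combinatorics using (_C_; nC1≡n; nCk+nC[k+1]≡[n+1]C[k+1])
open import Data.Nat.Tactic.RingSolver using (solve-∀)
open import Data.Product using (_×_; _,_; proj₁; map₁; map₂; uncurry)
open import Data.Rational using (ℚ; 0ℚ; _-_; toℚᵘ) renaming (_+_ to _+ℚ_; _*_ to _*ℚ_)
import Data.Rational.Properties as ℚ
open import Data.Rational.Solver using (module +-*-Solver)
import Data.Rational.Unnormalised as ℚᵘ
import Data.Rational.Unnormalised.Properties as ℚᵘ
open import Data.List.Relation.Unary.Unique.DecPropositional ℚ._≟_ using (unique?)
open import Data.List.Relation.Unary.Unique.DecPropositional.Properties ℚ._≟_ using (deduplicate-!)
open import Data.Sum using (inj₁; inj₂)
open import Data.Unit using (tt)
open import Data.Vec using (Vec; []; _∷_; countᵇ; tabulate)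
import Data.Vec.Relation.Unary.All as Vec
open import Function using (_∘_; id)
open import Relation.Binary.PropositionalEquality hiding ([_])
open import Relation.Nullary using (yes; no)
open import Relation.Nullary.Decidable using (T?; toWitness)

open import Defs

open import Algebra.Properties.CommutativeSemigroup (CommutativeMonoid.commutativeSemigroup ∧-commutativeMonoid)
  using () renaming (x∙yz≈y∙xz to ∧-swapˡ)
open import Algebra.Properties.CommutativeSemigroup ℕ.+-commutativeSemigroup
  using () renaming (interchange to +-interchange)
open +-*-Solver using (solve; _:=_; _:+_; _:-_)

private
  variable
    A B : Set
    m n : ℕ

≡ᵇ-refl : ∀ a → (a ≡ᵇ a) ≡ true
≡ᵇ-refl zero = refl
≡ᵇ-refl (suc a) = ≡ᵇ-refl a

≡ᵇ-true⇒≡ : ∀ {a b} → (a ≡ᵇ b) ≡ true → a ≡ b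
≡ᵇ-true⇒≡ {a} {b} eq = ℕ.≡ᵇ⇒≡ a b (subst T (sym eq) tt)

≢⇒≡ᵇ-false : ∀ {a b} → a ≢ b → (a ≡ᵇ b) ≡ false
≢⇒≡ᵇ-false a≢b = ¬-not (a≢b ∘ ≡ᵇ-true⇒≡)

<⇒≡ᵇ-false : ∀ {a b} → a < b → (a ≡ᵇ b) ≡ false
<⇒≡ᵇ-false a<b = ≢⇒≡ᵇ-false (ℕ.<⇒≢ a<b)

>⇒≡ᵇ-false : ∀ {a b} → b < a → (a ≡ᵇ b) ≡ false
>⇒≡ᵇ-false b<a = ≢⇒≡ᵇ-false (ℕ.>⇒≢ b<a)

∣-∣≡ᵇ1-sucˡ : ∀ a → (∣ suc a - a ∣ ≡ᵇ 1) ≡ true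
∣-∣≡ᵇ1-sucˡ zero = refl
∣-∣≡ᵇ1-sucˡ (suc a) = ∣-∣≡ᵇ1-sucˡ a

∣-∣≡ᵇ1-sucʳ : ∀ a → (∣ a - suc a ∣ ≡ᵇ 1) ≡ true
∣-∣≡ᵇ1-sucʳ zero = refl
∣-∣≡ᵇ1-sucʳ (suc a) = ∣-∣≡ᵇ1-sucʳ a

∣-∣≡ᵇ1-far : ∀ a b → suc a ≢ b → suc b ≢ a → (∣ a - b ∣ ≡ᵇ 1) ≡ false
∣-∣≡ᵇ1-far zero zero _ _ = refl
∣-∣≡ᵇ1-far zero (suc zero) 1≢1 _ = ⊥-elim (1≢1 refl)
∣-∣≡ᵇ1-far zero (suc (suc b)) _ _ = refl
∣-∣≡ᵇ1-far (suc zero) zero _ 1≢1 = ⊥-elim (1≢1 refl)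
∣-∣≡ᵇ1-far (suc (suc a)) zero _ _ = refl
∣-∣≡ᵇ1-far (suc a) (suc b) 2+a≢1+b 2+b≢1+a =
  ∣-∣≡ᵇ1-far a b (2+a≢1+b ∘ cong suc) (2+b≢1+a ∘ cong suc)

indicator : Bool → ℕ
indicator b = if b then 1 else 0

countᵇ-∷ : ∀ (p : A → Bool) a (v : Vec A m) → countᵇ p (a ∷ v) ≡ indicator (p a) + countᵇ p v
countᵇ-∷ p a v with p a
... | true = refl
... | false = refl

filterᵇ-cong : ∀ {p q : A → Bool} → (∀ x → p x ≡ q x) → ∀ xs → filterᵇ p xs ≡ filterᵇ q xs
filterᵇ-cong {p = p} {q} p≗q = List.filter-≐ (T? ∘ p) (T? ∘ q)
  ((λ {x} → subst T (p≗q x)) , (λ {x} → subst T (sym (p≗q x))))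

filterᵇ-const-∧ : ∀ b (q : A → Bool) xs →
  filterᵇ (λ x → b ∧ q x) xs ≡ (if b then filterᵇ q xs else [])
filterᵇ-const-∧ true q xs = refl
filterᵇ-const-∧ false q xs = List.filter-none (T? ∘ λ _ → false) (All.universal (λ _ → id) xs)

filterᵇ-map : ∀ (p : B → Bool) (f : A → B) xs → filterᵇ p (map f xs) ≡ map f (filterᵇ (p ∘ f) xs)
filterᵇ-map p f [] = refl
filterᵇ-map p f (x ∷ xs) with p (f x)
... | true = cong (f x ∷_) (filterᵇ-map p f xs)
... | false = filterᵇ-map p f xs

filterᵇ-concatMap : ∀ (p : B → Bool) (f : A → List B) xs →
  filterᵇ p (concatMap f xs) ≡ concatMap (filterᵇ p ∘ f) xs
filterᵇ-concatMap p f [] = refl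
filterᵇ-concatMap p f (x ∷ xs) =
  trans (List.filter-++ (T? ∘ p) (f x) _) (cong (filterᵇ p (f x) ++_) (filterᵇ-concatMap p f xs))

concatMap-filterᵇ : ∀ (p : A → Bool) (f : A → List B) xs →
  concatMap f (filterᵇ p xs) ≡ concatMap (λ x → if p x then f x else []) xs
concatMap-filterᵇ p f [] = refl
concatMap-filterᵇ p f (x ∷ xs) with p x
... | true = trans (List.concatMap-++ f [ x ] (filterᵇ p xs))
                   (cong₂ _++_ (List.++-identityʳ (f x)) (concatMap-filterᵇ p f xs))
... | false = concatMap-filterᵇ p f xs

concatMap-++-↭ : ∀ (f g : A → List B) xs →
  concatMap (λ x → f x ++ g x) xs ↭ concatMap f xs ++ concatMap g xs
concatMap-++-↭ f g [] = ↭-refl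
concatMap-++-↭ f g (x ∷ xs) = begin
  (f x ++ g x) ++ concatMap (λ x → f x ++ g x) xs    ≡⟨ List.++-assoc (f x) (g x) _ ⟩
  f x ++ g x ++ concatMap (λ x → f x ++ g x) xs      ↭⟨ ↭.++⁺ˡ (f x) (↭.++⁺ˡ (g x) (concatMap-++-↭ f g xs)) ⟩
  f x ++ g x ++ concatMap f xs ++ concatMap g xs     ↭⟨ ↭.++⁺ˡ (f x) (↭.shifts (g x) (concatMap f xs)) ⟩
  f x ++ concatMap f xs ++ g x ++ concatMap g xs     ≡⟨ List.++-assoc (f x) (concatMap f xs) _ ⟨
  (f x ++ concatMap f xs) ++ g x ++ concatMap g xs   ∎
  where open PermutationReasoning

map-if : ∀ (f : A → B) x xs → map f (if x then xs else []) ≡ (if x then map f xs else [])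
map-if f true xs = refl
map-if f false xs = refl

Unique-⊆⇒length≤ : ∀ {xs ys : List A} → Unique xs → xs ⊆ ys → length xs ≤ length ys
Unique-⊆⇒length≤ {xs = []} [] xs⊆ys = z≤n
Unique-⊆⇒length≤ {xs = x ∷ xs} {ys} (x∉xs ∷ xs-unique) xs⊆ys
  with ys₁ , ys₂ , refl ← ∈-∃++ (xs⊆ys (here refl)) = begin
  suc (length xs)             ≤⟨ s≤s (Unique-⊆⇒length≤ xs-unique xs⊆ys₁++ys₂) ⟩
  suc (length (ys₁ ++ ys₂))   ≡⟨ List.length-++-sucʳ ys₁ x ys₂ ⟨
  length (ys₁ ++ x ∷ ys₂)     ∎
  where
  open ℕ.≤-Reasoning
  xs⊆ys₁++ys₂ : xs ⊆ ys₁ ++ ys₂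
  xs⊆ys₁++ys₂ {y} y∈xs with ∈-++⁻ ys₁ (xs⊆ys (there y∈xs))
  ... | inj₁ y∈ys₁ = ∈-++⁺ˡ y∈ys₁
  ... | inj₂ (here refl) = ⊥-elim (All.lookup x∉xs y∈xs refl)
  ... | inj₂ (there y∈ys₂) = ∈-++⁺ʳ ys₁ y∈ys₂

range : ℕ → ℕ → List ℕ
range lo zero = []
range lo (suc k) = lo ∷ range (suc lo) k

applyUpTo-range : ∀ (f : ℕ → ℕ) lo k → (∀ i → f i ≡ lo + i) → applyUpTo f k ≡ range lo k
applyUpTo-range f lo zero f≗lo+ = refl
applyUpTo-range f lo (suc k) f≗lo+ = cong₂ _∷_ (trans (f≗lo+ 0) (ℕ.+-identityʳ lo))
  (applyUpTo-range (f ∘ suc) (suc lo) k (λ i → trans (f≗lo+ (suc i)) (ℕ.+-suc lo i)))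

map-suc-upTo : ∀ n → map suc (upTo n) ≡ range 1 n
map-suc-upTo n = trans (List.map-upTo suc n) (applyUpTo-range suc 1 n (λ _ → refl))

range-++ : ∀ lo x y → range lo (x + y) ≡ range lo x ++ range (lo + x) y
range-++ lo zero y = cong (λ l → range l y) (sym (ℕ.+-identityʳ lo))
range-++ lo (suc x) y = cong (lo ∷_)
  (trans (range-++ (suc lo) x y) (cong (λ l → range (suc lo) x ++ range l y) (sym (ℕ.+-suc lo x))))

All-range : ∀ {P : ℕ → Set} lo k → (∀ b → lo ≤ b → b < lo + k → P b) → All P (range lo k)
All-range lo zero h = []
All-range lo (suc k) h = h lo ℕ.≤-refl (ℕ.m<m+n lo (s≤s z≤n))
  ∷ All-range (suc lo) k (λ b lo<b b<lo+k → h b (ℕ.<⇒≤ lo<b) (subst (b <_) (sym (ℕ.+-suc lo k)) b<lo+k))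

∈-range⁻ : ∀ {lo k b} → b ∈ range lo k → lo ≤ b × b < lo + k
∈-range⁻ {lo} {suc k} (here refl) = ℕ.≤-refl , ℕ.m<m+n lo (s≤s z≤n)
∈-range⁻ {lo} {suc k} {b} (there b∈) with ∈-range⁻ b∈
... | lo<b , b<1+lo+k = ℕ.<⇒≤ lo<b , subst (b <_) (sym (ℕ.+-suc lo k)) b<1+lo+k

filterᵇ-range-none : ∀ (p : ℕ → Bool) lo k → (∀ b → lo ≤ b → b < lo + k → p b ≡ false) →
  filterᵇ p (range lo k) ≡ []
filterᵇ-range-none p lo k h = List.filter-none (T? ∘ p)
  (All-range lo k (λ b lo≤b b<lo+k → subst T (h b lo≤b b<lo+k)))

filterᵇ-range-single : ∀ (p : ℕ → Bool) lo k c → lo ≤ c → c < lo + k → p c ≡ true →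
  (∀ b → lo ≤ b → b < lo + k → b ≢ c → p b ≡ false) → filterᵇ p (range lo k) ≡ [ c ]
filterᵇ-range-single p lo zero c lo≤c c<lo+k pc h =
  ⊥-elim (ℕ.<-irrefl refl (ℕ.≤-trans c<lo+k (subst (_≤ c) (sym (ℕ.+-identityʳ lo)) lo≤c)))
filterᵇ-range-single p lo (suc k) c lo≤c c<lo+k pc h with lo ℕ.≟ c
... | yes refl rewrite pc = cong (lo ∷_) (filterᵇ-range-none p (suc lo) k
        (λ b lo<b b<lo+k → h b (ℕ.<⇒≤ lo<b) (subst (b <_) (sym (ℕ.+-suc lo k)) b<lo+k) (ℕ.>⇒≢ lo<b)))
... | no lo≢c rewrite h lo ℕ.≤-refl (ℕ.m<m+n lo (s≤s z≤n)) lo≢c =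
  filterᵇ-range-single p (suc lo) k c (ℕ.≤∧≢⇒< lo≤c lo≢c) (subst (c <_) (ℕ.+-suc lo k) c<lo+k) pc
    (λ b lo<b b<lo+k → h b (ℕ.<⇒≤ lo<b) (subst (b <_) (sym (ℕ.+-suc lo k)) b<lo+k))

concatMap-≡ᵇ-range : ∀ {a} (f : ℕ → List A) → 1 ≤ a → a ≤ n →
  concatMap (λ b → if a ≡ᵇ b then f b else []) (range 1 n) ≡ f a
concatMap-≡ᵇ-range {n = n} {a} f 1≤a a≤n = begin
  concatMap (λ b → if a ≡ᵇ b then f b else []) (range 1 n)
    ≡⟨ concatMap-filterᵇ (a ≡ᵇ_) f (range 1 n) ⟨
  concatMap f (filterᵇ (a ≡ᵇ_) (range 1 n))
    ≡⟨ cong (concatMap f) filter-a ⟩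
  f a ++ []
    ≡⟨ List.++-identityʳ (f a) ⟩
  f a ∎
  where
  open ≡-Reasoning
  filter-a : filterᵇ (a ≡ᵇ_) (range 1 n) ≡ [ a ]
  filter-a = filterᵇ-range-single (a ≡ᵇ_) 1 n a 1≤a (s≤s a≤n) (≡ᵇ-refl a)
    (λ b _ _ b≢a → ≢⇒≡ᵇ-false (b≢a ∘ sym))

sumℚ-++ : ∀ xs ys → sumℚ (xs ++ ys) ≡ sumℚ xs +ℚ sumℚ ys
sumℚ-++ [] ys = sym (ℚ.+-identityˡ (sumℚ ys))
sumℚ-++ (x ∷ xs) ys = trans (cong (x +ℚ_) (sumℚ-++ xs ys)) (sym (ℚ.+-assoc x (sumℚ xs) (sumℚ ys)))

sumℚ-↭ : ∀ {xs ys} → xs ↭ ys → sumℚ xs ≡ sumℚ ys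
sumℚ-↭ xs↭ys = Perm.foldr-commMonoid (CommutativeMonoid.setoid ℚ.+-0-commutativeMonoid)
  ℚ.+-0-isCommutativeMonoid (↭⇒↭ₛ xs↭ys)

frac-0 : ∀ d → frac (+ 0) d ≡ 0ℚ
frac-0 zero = refl
frac-0 (suc d) = ℚ.0/n≡0 (suc d)

frac-+ : ∀ p q d → frac (+ (p + q)) d ≡ frac (+ p) d +ℚ frac (+ q) d
frac-+ p q zero = refl
frac-+ p q (suc d) = ℚ.toℚᵘ-injective (begin
  toℚᵘ (frac (+ (p + q)) (suc d))
    ≈⟨ ℚ.toℚᵘ-fromℚᵘ (ℚᵘ.mkℚᵘ (+ (p + q)) d) ⟩
  ℚᵘ.mkℚᵘ (+ (p + q)) d
    ≈⟨ ℚᵘ.*≡* (numerators (+ p) (+ q) (+ suc d)) ⟩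
  ℚᵘ.mkℚᵘ (+ p) d ℚᵘ.+ ℚᵘ.mkℚᵘ (+ q) d
    ≈⟨ ℚᵘ.+-cong (ℚᵘ.≃-sym (ℚ.toℚᵘ-fromℚᵘ (ℚᵘ.mkℚᵘ (+ p) d))) (ℚᵘ.≃-sym (ℚ.toℚᵘ-fromℚᵘ (ℚᵘ.mkℚᵘ (+ q) d))) ⟩
  toℚᵘ (frac (+ p) (suc d)) ℚᵘ.+ toℚᵘ (frac (+ q) (suc d))
    ≈⟨ ℚᵘ.≃-sym (ℚ.toℚᵘ-homo-+ (frac (+ p) (suc d)) (frac (+ q) (suc d))) ⟩
  toℚᵘ (frac (+ p) (suc d) +ℚ frac (+ q) (suc d)) ∎)
  where
  open ℚᵘ.≃-Reasoning
  numerators : ∀ x y s → (x ℤ.+ y) ℤ.* (s ℤ.* s) ≡ (x ℤ.* s ℤ.+ y ℤ.* s) ℤ.* s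
  numerators = ℤ-solve-∀

-- The bracket of l(v_r) for a vertex of degree D with p near-end and q end coordinates.
leverageBracket : ℕ → ℕ → ℕ → ℚ
leverageBracket D p q = frac (+ p) (2 * D ∸ 1) - frac (+ q) (2 * D + 1)

leverageBracket-zero : ∀ D → leverageBracket D 0 0 ≡ 0ℚ
leverageBracket-zero D rewrite frac-0 (2 * D ∸ 1) | frac-0 (2 * D + 1) = refl

leverageBracket-+ : ∀ D p q p′ q′ →
  leverageBracket D p q +ℚ leverageBracket D p′ q′ ≡ leverageBracket D (p + p′) (q + q′)
leverageBracket-+ D p q p′ q′
  rewrite frac-+ p p′ (2 * D ∸ 1) | frac-+ q q′ (2 * D + 1) =
    -+-interchange (frac (+ p) (2 * D ∸ 1)) (frac (+ q) (2 * D + 1))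
                   (frac (+ p′) (2 * D ∸ 1)) (frac (+ q′) (2 * D + 1))
  where
  -+-interchange : ∀ a b c d → (a - b) +ℚ (c - d) ≡ (a +ℚ c) - (b +ℚ d)
  -+-interchange = solve 4 (λ a b c d → (a :- b) :+ (c :- d) := (a :+ c) :- (b :+ d)) refl

sumℚ-single : ∀ D p q {x} → x ≡ leverageBracket D p q → sumℚ [ x ] ≡ leverageBracket D p q
sumℚ-single D p q {x} x≡ = trans (ℚ.+-identityʳ x) x≡

sumℚ-pair : ∀ D p q p′ q′ {x y} → x ≡ leverageBracket D p q → y ≡ leverageBracket D p′ q′ →
  sumℚ (x ∷ y ∷ []) ≡ leverageBracket D (p + p′) (q + q′)
sumℚ-pair D p q p′ q′ {x} {y} x≡ y≡ =
  trans (cong (x +ℚ_) (ℚ.+-identityʳ y)) (trans (cong₂ _+ℚ_ x≡ y≡) (leverageBracket-+ D p q p′ q′))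

leverageTerm : ℕ → ℕ → ℚ
leverageTerm d e = frac (d ⊖ e) (d + e)

2*n+1≡1+n+n : ∀ n → 2 * n + 1 ≡ suc (n + n)
2*n+1≡1+n+n = solve-∀

2*[1+n]∸1≡1+n+n : ∀ n → 2 * suc n ∸ 1 ≡ suc (n + n)
2*[1+n]∸1≡1+n+n n = trans (ℕ.+-suc n (n + 0)) (cong (λ k → suc (n + k)) (ℕ.+-identityʳ n))

leverageTerm-diag : ∀ d → leverageTerm d d ≡ leverageBracket d 0 0
leverageTerm-diag d rewrite ℤ.n⊖n≡0 d = trans (frac-0 (d + d)) (sym (leverageBracket-zero d))

leverageTerm-suc : ∀ d → leverageTerm d (suc d) ≡ leverageBracket d 0 1
leverageTerm-suc d rewrite ℤ.⊖-< (ℕ.n<1+n d) | ℕ.m+n∸n≡m 1 d | ℕ.+-suc d d | frac-0 (2 * d ∸ 1)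
  | 2*n+1≡1+n+n d = sym (ℚ.+-identityˡ _)

leverageTerm-pred : ∀ e → leverageTerm (suc e) e ≡ leverageBracket (suc e) 1 0
leverageTerm-pred e rewrite ℤ.⊖-≥ (ℕ.n≤1+n e) | ℕ.m+n∸n≡m 1 e | frac-0 (2 * suc e + 1)
  | 2*[1+n]∸1≡1+n+n e = sym (ℚ.+-identityʳ _)

leverageTerm-1-2 : ∀ c → leverageTerm (c + 1) (c + 2) ≡ leverageBracket (c + 1) 0 1
leverageTerm-1-2 c rewrite ℕ.+-suc c 1 = leverageTerm-suc (c + 1)

leverageTerm-2-1 : ∀ c → leverageTerm (c + 2) (c + 1) ≡ leverageBracket (c + 2) 1 0
leverageTerm-2-1 c rewrite ℕ.+-suc c 1 = leverageTerm-pred (c + 1)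

-- The path P_n

pathNbrs : ℕ → ℕ → List ℕ
pathNbrs n a = filterᵇ (λ b → ∣ a - b ∣ ≡ᵇ 1) (range 1 n)

pathNbrs-first : ∀ n → 2 ≤ n → pathNbrs n 1 ≡ [ 2 ]
pathNbrs-first n 2≤n = filterᵇ-range-single _ 1 n 2 (s≤s z≤n) (s≤s 2≤n) refl
  (λ b 1≤b _ b≢2 → ∣-∣≡ᵇ1-far 1 b (b≢2 ∘ sym) (ℕ.<⇒≢ 1≤b ∘ sym ∘ ℕ.suc-injective))

pathNbrs-last : ∀ k → pathNbrs (2 + k) (2 + k) ≡ [ 1 + k ]
pathNbrs-last k =
  filterᵇ-range-single _ 1 (2 + k) (1 + k) (s≤s z≤n) (ℕ.m≤n⇒m≤1+n (ℕ.n<1+n (1 + k))) (∣-∣≡ᵇ1-sucˡ (1 + k))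
  (λ b _ b<3+k b≢1+k → ∣-∣≡ᵇ1-far (2 + k) b (ℕ.>⇒≢ b<3+k) (b≢1+k ∘ ℕ.suc-injective))

pathNbrs-inner : ∀ n x → 1 ≤ x → suc x < n → pathNbrs n (suc x) ≡ x ∷ suc (suc x) ∷ []
pathNbrs-inner n x 1≤x 1+x<n = begin
  filterᵇ adjacentᵇ (range 1 n)
    ≡⟨ cong (filterᵇ adjacentᵇ ∘ range 1) (ℕ.m+[n∸m]≡n (ℕ.<⇒≤ 1+x<n)) ⟨
  filterᵇ adjacentᵇ (range 1 (suc x + (n ∸ suc x)))
    ≡⟨ cong (filterᵇ adjacentᵇ) (range-++ 1 (suc x) (n ∸ suc x)) ⟩
  filterᵇ adjacentᵇ (range 1 (suc x) ++ range (2 + x) (n ∸ suc x))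
    ≡⟨ List.filter-++ (T? ∘ adjacentᵇ) (range 1 (suc x)) _ ⟩
  filterᵇ adjacentᵇ (range 1 (suc x)) ++ filterᵇ adjacentᵇ (range (2 + x) (n ∸ suc x))
    ≡⟨ cong₂ _++_ below above ⟩
  x ∷ suc (suc x) ∷ [] ∎
  where
  open ≡-Reasoning
  adjacentᵇ : ℕ → Bool
  adjacentᵇ b = ∣ suc x - b ∣ ≡ᵇ 1
  below : filterᵇ adjacentᵇ (range 1 (suc x)) ≡ [ x ]
  below = filterᵇ-range-single adjacentᵇ 1 (suc x) x 1≤x (ℕ.m≤n⇒m≤1+n (ℕ.n<1+n x)) (∣-∣≡ᵇ1-sucˡ x)
    (λ b _ b<2+x b≢x → ∣-∣≡ᵇ1-far (suc x) b (ℕ.>⇒≢ b<2+x) (b≢x ∘ ℕ.suc-injective))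
  above : filterᵇ adjacentᵇ (range (2 + x) (n ∸ suc x)) ≡ [ 2 + x ]
  above = filterᵇ-range-single adjacentᵇ (2 + x) (n ∸ suc x) (2 + x) ℕ.≤-refl
    (ℕ.m<m+n (2 + x) (ℕ.m<n⇒0<n∸m 1+x<n)) (∣-∣≡ᵇ1-sucʳ (suc x))
    (λ b 2+x≤b _ b≢2+x → ∣-∣≡ᵇ1-far (suc x) b (b≢2+x ∘ sym) (ℕ.>⇒≢ (ℕ.m≤n⇒m≤1+n 2+x≤b)))

pathDeg : ℕ → ℕ → ℕ
pathDeg n a = length (pathNbrs n a)

pathDeg-first : ∀ n → 2 ≤ n → pathDeg n 1 ≡ 1
pathDeg-first n 2≤n = cong length (pathNbrs-first n 2≤n)

pathDeg-last : ∀ k → pathDeg (2 + k) (2 + k) ≡ 1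
pathDeg-last k = cong length (pathNbrs-last k)

pathDeg-inner : ∀ n x → 1 ≤ x → suc x < n → pathDeg n (suc x) ≡ 2
pathDeg-inner n x 1≤x 1+x<n = cong length (pathNbrs-inner n x 1≤x 1+x<n)

isEnd : ℕ → ℕ → Bool
isEnd n a = (a ≡ᵇ 1) ∨ (a ≡ᵇ n)

isNearEnd : ℕ → ℕ → Bool
isNearEnd n a = (a ≡ᵇ 2) ∨ (suc a ≡ᵇ n)

-- For n ≥ 4 these five cases are disjoint: no vertex of P_n is adjacent to both end-points.
data PathPosition : ℕ → ℕ → Set where
  first       : ∀ k → PathPosition (4 + k) 1
  second      : ∀ k → PathPosition (4 + k) 2
  middle      : ∀ x r → PathPosition (5 + x + r) (3 + x)
  penultimate : ∀ k → PathPosition (4 + k) (3 + k)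
  last        : ∀ k → PathPosition (4 + k) (4 + k)

pathPosition : ∀ {n a} → 4 ≤ n → 1 ≤ a → a ≤ n → PathPosition n a
pathPosition {suc (suc (suc (suc k)))} {1} (s≤s (s≤s (s≤s (s≤s z≤n)))) _ _ = first k
pathPosition {suc (suc (suc (suc k)))} {2} (s≤s (s≤s (s≤s (s≤s z≤n)))) _ _ = second k
pathPosition {suc (suc (suc (suc k)))} {suc (suc (suc x))} (s≤s (s≤s (s≤s (s≤s z≤n)))) _
  (s≤s (s≤s (s≤s x≤1+k))) with compare x k
... | less .x r = middle x r
... | equal .k = penultimate k
... | greater .k zero = subst (λ t → PathPosition (4 + k) (4 + t)) (sym (ℕ.+-identityʳ k)) (last k)
... | greater .k (suc d) = ⊥-elim (ℕ.m+1+n≰m k (ℕ.≤-pred x≤1+k))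

isEnd-middle : ∀ x r → isEnd (5 + x + r) (3 + x) ≡ false
isEnd-middle x r = <⇒≡ᵇ-false (s≤s (ℕ.m≤n⇒m≤1+n (ℕ.m≤m+n x r)))

isNearEnd-middle : ∀ x r → isNearEnd (5 + x + r) (3 + x) ≡ false
isNearEnd-middle x r = <⇒≡ᵇ-false (s≤s (ℕ.m≤m+n x r))

isEnd-penultimate : ∀ k → isEnd (4 + k) (3 + k) ≡ false
isEnd-penultimate k = <⇒≡ᵇ-false (ℕ.n<1+n k)

isNearEnd-penultimate : ∀ k → isNearEnd (4 + k) (3 + k) ≡ true
isNearEnd-penultimate k = ≡ᵇ-refl k

isEnd-last : ∀ k → isEnd (4 + k) (4 + k) ≡ true
isEnd-last k = ≡ᵇ-refl k

isNearEnd-last : ∀ k → isNearEnd (4 + k) (4 + k) ≡ false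
isNearEnd-last k = >⇒≡ᵇ-false (ℕ.n<1+n k)

pathDeg-+-isEnd : ∀ {n a} → PathPosition n a → pathDeg n a + indicator (isEnd n a) ≡ 2
pathDeg-+-isEnd (first k) = cong (_+ 1) (pathDeg-first (4 + k) (s≤s (s≤s z≤n)))
pathDeg-+-isEnd (second k) = cong (_+ 0) (pathDeg-inner (4 + k) 1 (s≤s z≤n) (s≤s (s≤s (s≤s z≤n))))
pathDeg-+-isEnd (middle x r) rewrite isEnd-middle x r =
  cong (_+ 0) (pathDeg-inner (5 + x + r) (2 + x) (s≤s z≤n)
                             (s≤s (s≤s (s≤s (s≤s (ℕ.m≤n⇒m≤1+n (ℕ.m≤m+n x r)))))))
pathDeg-+-isEnd (penultimate k) rewrite isEnd-penultimate k =
  cong (_+ 0) (pathDeg-inner (4 + k) (2 + k) (s≤s z≤n) (ℕ.n<1+n (3 + k)))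
pathDeg-+-isEnd (last k) rewrite isEnd-last k = cong (_+ 1) (pathDeg-last (2 + k))

isEnd-+-isNearEnd≤1 : ∀ {n a} → PathPosition n a → indicator (isEnd n a) + indicator (isNearEnd n a) ≤ 1
isEnd-+-isNearEnd≤1 (first k) = ℕ.≤-refl
isEnd-+-isNearEnd≤1 (second k) = ℕ.≤-refl
isEnd-+-isNearEnd≤1 (middle x r) rewrite isEnd-middle x r | isNearEnd-middle x r = z≤n
isEnd-+-isNearEnd≤1 (penultimate k) rewrite isEnd-penultimate k | isNearEnd-penultimate k = ℕ.≤-refl
isEnd-+-isNearEnd≤1 (last k) rewrite isEnd-last k | isNearEnd-last k = ℕ.≤-refl

contribution-subst : ∀ n a c {d bs q e} →
  pathDeg n a ≡ d → pathNbrs n a ≡ bs → isNearEnd n a ≡ q → isEnd n a ≡ e →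
  sumℚ (map (λ b → leverageTerm (c + d) (c + pathDeg n b)) bs)
    ≡ leverageBracket (c + d) (indicator q) (indicator e) →
  sumℚ (map (λ b → leverageTerm (c + pathDeg n a) (c + pathDeg n b)) (pathNbrs n a))
    ≡ leverageBracket (c + pathDeg n a) (indicator (isNearEnd n a)) (indicator (isEnd n a))
contribution-subst n a c refl refl refl refl sum≡ = sum≡

term-subst : ∀ n b c d {e y} → pathDeg n b ≡ e → leverageTerm (c + d) (c + e) ≡ y →
  leverageTerm (c + d) (c + pathDeg n b) ≡ y
term-subst n b c d refl term≡ = term≡

pathContribution : ∀ {n a} → PathPosition n a → ∀ c →
  sumℚ (map (λ b → leverageTerm (c + pathDeg n a) (c + pathDeg n b)) (pathNbrs n a))
    ≡ leverageBracket (c + pathDeg n a) (indicator (isNearEnd n a)) (indicator (isEnd n a))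
pathContribution (first k) c =
  contribution-subst (4 + k) 1 c (pathDeg-first (4 + k) 2≤4+k) (pathNbrs-first (4 + k) 2≤4+k) refl refl
    (sumℚ-single (c + 1) 0 1
      (term-subst (4 + k) 2 c 1 (pathDeg-inner (4 + k) 1 (s≤s z≤n) 2<4+k) (leverageTerm-1-2 c)))
  where
  2≤4+k : 2 ≤ 4 + k
  2≤4+k = s≤s (s≤s z≤n)
  2<4+k : 2 < 4 + k
  2<4+k = s≤s (s≤s (s≤s z≤n))
pathContribution (second k) c =
  contribution-subst (4 + k) 2 c (pathDeg-inner (4 + k) 1 (s≤s z≤n) 2<4+k)
    (pathNbrs-inner (4 + k) 1 (s≤s z≤n) 2<4+k) refl refl
    (sumℚ-pair (c + 2) 1 0 0 0
      (term-subst (4 + k) 1 c 2 (pathDeg-first (4 + k) (ℕ.<⇒≤ 2<4+k)) (leverageTerm-2-1 c))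
      (term-subst (4 + k) 3 c 2 (pathDeg-inner (4 + k) 2 (s≤s z≤n) (s≤s (s≤s (s≤s (s≤s z≤n)))))
        (leverageTerm-diag (c + 2))))
  where
  2<4+k : 2 < 4 + k
  2<4+k = s≤s (s≤s (s≤s z≤n))
pathContribution (middle x r) c =
  contribution-subst (5 + x + r) (3 + x) c (pathDeg-inner (5 + x + r) (2 + x) (s≤s z≤n) 3+x<5+x+r)
    (pathNbrs-inner (5 + x + r) (2 + x) (s≤s z≤n) 3+x<5+x+r) (isNearEnd-middle x r) (isEnd-middle x r)
    (sumℚ-pair (c + 2) 0 0 0 0
      (term-subst (5 + x + r) (2 + x) c 2
        (pathDeg-inner (5 + x + r) (1 + x) (s≤s z≤n) (ℕ.<-trans (ℕ.n<1+n (2 + x)) 3+x<5+x+r))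
        (leverageTerm-diag (c + 2)))
      (term-subst (5 + x + r) (4 + x) c 2
        (pathDeg-inner (5 + x + r) (3 + x) (s≤s z≤n) (s≤s 3+x<4+x+r))
        (leverageTerm-diag (c + 2))))
  where
  3+x<4+x+r : 3 + x < 4 + x + r
  3+x<4+x+r = s≤s (s≤s (s≤s (s≤s (ℕ.m≤m+n x r))))
  3+x<5+x+r : 3 + x < 5 + x + r
  3+x<5+x+r = ℕ.m≤n⇒m≤1+n 3+x<4+x+r
pathContribution (penultimate k) c =
  contribution-subst (4 + k) (3 + k) c (pathDeg-inner (4 + k) (2 + k) (s≤s z≤n) (ℕ.n<1+n (3 + k)))
    (pathNbrs-inner (4 + k) (2 + k) (s≤s z≤n) (ℕ.n<1+n (3 + k))) (isNearEnd-penultimate k) (isEnd-penultimate k)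
    (sumℚ-pair (c + 2) 0 0 1 0
      (term-subst (4 + k) (2 + k) c 2
        (pathDeg-inner (4 + k) (1 + k) (s≤s z≤n) (ℕ.m≤n⇒m≤1+n (ℕ.n<1+n (2 + k))))
        (leverageTerm-diag (c + 2)))
      (term-subst (4 + k) (4 + k) c 2 (pathDeg-last (2 + k)) (leverageTerm-2-1 c)))
pathContribution (last k) c =
  contribution-subst (4 + k) (4 + k) c (pathDeg-last (2 + k)) (pathNbrs-last (2 + k))
    (isNearEnd-last k) (isEnd-last k)
    (sumℚ-single (c + 1) 0 1
      (term-subst (4 + k) (3 + k) c 1 (pathDeg-inner (4 + k) (2 + k) (s≤s z≤n) (ℕ.n<1+n (3 + k)))
        (leverageTerm-1-2 c)))

IsVertex : ℕ → Vec ℕ m → Set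
IsVertex n = Vec.All (λ a → 1 ≤ a × a ≤ n)

vertices-suc : ∀ n m → vertices n (suc m) ≡ concatMap (λ b → map (b ∷_) (vertices n m)) (range 1 n)
vertices-suc n m = cong (concatMap (λ b → map (b ∷_) (vertices n m))) (map-suc-upTo n)

filterᵇ-vertices-suc : ∀ n m (p : Vec ℕ (suc m) → Bool) →
  filterᵇ p (vertices n (suc m))
    ≡ concatMap (λ b → map (b ∷_) (filterᵇ (p ∘ (b ∷_)) (vertices n m))) (range 1 n)
filterᵇ-vertices-suc n m p = trans (cong (filterᵇ p) (vertices-suc n m))
  (trans (filterᵇ-concatMap p _ (range 1 n))
         (List.concatMap-cong (λ b → filterᵇ-map p (b ∷_) (vertices n m)) (range 1 n)))

∈-vertices⁻ : ∀ {v : Vec ℕ m} → v ∈ vertices n m → IsVertex n v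
∈-vertices⁻ {zero} {v = []} _ = Vec.[]
∈-vertices⁻ {suc m} {n} v∈
  with b , b∈ , v∈b∷ ← find (∈-concatMap⁻ (λ b → map (b ∷_) (vertices n m)) {xs = range 1 n}
                                          (subst (_ ∈_) (vertices-suc n m) v∈))
  with w , w∈ , refl ← ∈-map⁻ (b ∷_) v∈b∷
  = map₂ ℕ.≤-pred (∈-range⁻ b∈) Vec.∷ ∈-vertices⁻ w∈

identicalᵇ : Vec ℕ m → Vec ℕ m → Bool
identicalᵇ v w = (countDiff v w ≡ᵇ 0) ∧ diffsByOne v w

identicalᵇ-∷ : ∀ a b (v w : Vec ℕ m) → identicalᵇ (a ∷ v) (b ∷ w) ≡ (a ≡ᵇ b) ∧ identicalᵇ v w
identicalᵇ-∷ a b v w with a ≡ᵇ b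
... | true = refl
... | false = refl

filterᵇ-identicalᵇ : ∀ {v : Vec ℕ m} → IsVertex n v → filterᵇ (identicalᵇ v) (vertices n m) ≡ [ v ]
filterᵇ-identicalᵇ Vec.[] = refl
filterᵇ-identicalᵇ {suc m} {n} {a ∷ v} ((1≤a , a≤n) Vec.∷ v-vertex) = begin
  filterᵇ (identicalᵇ (a ∷ v)) (vertices n (suc m))
    ≡⟨ filterᵇ-vertices-suc n m (identicalᵇ (a ∷ v)) ⟩
  concatMap (λ b → map (b ∷_) (filterᵇ (identicalᵇ (a ∷ v) ∘ (b ∷_)) (vertices n m))) (range 1 n)
    ≡⟨ List.concatMap-cong slice (range 1 n) ⟩
  concatMap (λ b → if a ≡ᵇ b then [ b ∷ v ] else []) (range 1 n)
    ≡⟨ concatMap-≡ᵇ-range (λ b → [ b ∷ v ]) 1≤a a≤n ⟩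
  [ a ∷ v ] ∎
  where
  open ≡-Reasoning
  slice : ∀ b → map (b ∷_) (filterᵇ (identicalᵇ (a ∷ v) ∘ (b ∷_)) (vertices n m))
                  ≡ (if a ≡ᵇ b then [ b ∷ v ] else [])
  slice b = begin
    map (b ∷_) (filterᵇ (identicalᵇ (a ∷ v) ∘ (b ∷_)) (vertices n m))
      ≡⟨ cong (map (b ∷_)) (filterᵇ-cong (identicalᵇ-∷ a b v) (vertices n m)) ⟩
    map (b ∷_) (filterᵇ (λ w → (a ≡ᵇ b) ∧ identicalᵇ v w) (vertices n m))
      ≡⟨ cong (map (b ∷_)) (filterᵇ-const-∧ (a ≡ᵇ b) (identicalᵇ v) (vertices n m)) ⟩
    map (b ∷_) (if a ≡ᵇ b then filterᵇ (identicalᵇ v) (vertices n m) else [])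
      ≡⟨ map-if (b ∷_) (a ≡ᵇ b) _ ⟩
    (if a ≡ᵇ b then map (b ∷_) (filterᵇ (identicalᵇ v) (vertices n m)) else [])
      ≡⟨ cong (λ vs → if a ≡ᵇ b then map (b ∷_) vs else []) (filterᵇ-identicalᵇ v-vertex) ⟩
    (if a ≡ᵇ b then [ b ∷ v ] else []) ∎

∈-vertices⁺ : ∀ {v : Vec ℕ m} → IsVertex n v → v ∈ vertices n m
∈-vertices⁺ {v = v} v-vertex =
  proj₁ (∈-filter⁻ (T? ∘ identicalᵇ v) (subst (v ∈_) (sym (filterᵇ-identicalᵇ v-vertex)) (here refl)))

nbhd-IsVertex : ∀ (v : Vec ℕ m) → All (IsVertex n) (nbhd n v)
nbhd-IsVertex v = All.tabulate (λ w∈ → ∈-vertices⁻ (proj₁ (∈-filter⁻ (T? ∘ adj v) w∈)))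

pathNbrs-inRange : ∀ n a → All (λ b → 1 ≤ b × b ≤ n) (pathNbrs n a)
pathNbrs-inRange n a = All.tabulate (λ b∈ → map₂ ℕ.≤-pred (∈-range⁻ (proj₁ (∈-filter⁻ _ b∈))))

nbhd-slice : ∀ {v : Vec ℕ m} → IsVertex n v → ∀ a b →
  map (b ∷_) (filterᵇ (adj (a ∷ v) ∘ (b ∷_)) (vertices n m))
    ≡ (if a ≡ᵇ b then map (b ∷_) (nbhd n v) else []) ++ (if ∣ a - b ∣ ≡ᵇ 1 then [ b ∷ v ] else [])
nbhd-slice {m} {n} {v} v-vertex a b with a ≡ᵇ b in a≡ᵇb
... | true with refl ← ≡ᵇ-true⇒≡ {a} {b} a≡ᵇb rewrite ℕ.∣n-n∣≡0 a = sym (List.++-identityʳ _)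
... | false = begin
  -- For a ≢ b, adj (a ∷ v) (b ∷ w) has computed to the filter predicate below.
  map (b ∷_) (filterᵇ (λ w → (countDiff v w ≡ᵇ 0) ∧ (adjacentᵇ ∧ diffsByOne v w)) (vertices n m))
    ≡⟨ cong (map (b ∷_)) (filterᵇ-cong (λ w → ∧-swapˡ (countDiff v w ≡ᵇ 0) adjacentᵇ _)
                                       (vertices n m)) ⟩
  map (b ∷_) (filterᵇ (λ w → adjacentᵇ ∧ identicalᵇ v w) (vertices n m))
    ≡⟨ cong (map (b ∷_)) (filterᵇ-const-∧ adjacentᵇ (identicalᵇ v) (vertices n m)) ⟩
  map (b ∷_) (if adjacentᵇ then filterᵇ (identicalᵇ v) (vertices n m) else [])
    ≡⟨ map-if (b ∷_) adjacentᵇ _ ⟩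
  (if adjacentᵇ then map (b ∷_) (filterᵇ (identicalᵇ v) (vertices n m)) else [])
    ≡⟨ cong (λ vs → if adjacentᵇ then map (b ∷_) vs else []) (filterᵇ-identicalᵇ v-vertex) ⟩
  (if adjacentᵇ then [ b ∷ v ] else []) ∎
  where
  open ≡-Reasoning
  adjacentᵇ : Bool
  adjacentᵇ = ∣ a - b ∣ ≡ᵇ 1

nbhd-∷-↭ : ∀ {a} {v : Vec ℕ m} → IsVertex n v → 1 ≤ a → a ≤ n →
  nbhd n (a ∷ v) ↭ map (a ∷_) (nbhd n v) ++ map (_∷ v) (pathNbrs n a)
nbhd-∷-↭ {m} {n} {a} {v} v-vertex 1≤a a≤n = begin
  nbhd n (a ∷ v)
    ≡⟨ filterᵇ-vertices-suc n m (adj (a ∷ v)) ⟩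
  concatMap (λ b → map (b ∷_) (filterᵇ (adj (a ∷ v) ∘ (b ∷_)) (vertices n m))) (range 1 n)
    ≡⟨ List.concatMap-cong (nbhd-slice v-vertex a) (range 1 n) ⟩
  concatMap (λ b → vertical b ++ horizontal b) (range 1 n)
    ↭⟨ concatMap-++-↭ vertical horizontal (range 1 n) ⟩
  concatMap vertical (range 1 n) ++ concatMap horizontal (range 1 n)
    ≡⟨ cong₂ _++_ (concatMap-≡ᵇ-range (λ b → map (b ∷_) (nbhd n v)) 1≤a a≤n)
                   (sym (concatMap-filterᵇ (λ b → ∣ a - b ∣ ≡ᵇ 1) (λ b → [ b ∷ v ]) (range 1 n))) ⟩
  map (a ∷_) (nbhd n v) ++ concatMap (λ b → [ b ∷ v ]) (pathNbrs n a)
    ≡⟨ cong (map (a ∷_) (nbhd n v) ++_) (trans (sym (List.concatMap-map [_] (_∷ v) (pathNbrs n a)))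
                                                (List.concatMap-pure (map (_∷ v) (pathNbrs n a)))) ⟩
  map (a ∷_) (nbhd n v) ++ map (_∷ v) (pathNbrs n a) ∎
  where
  open PermutationReasoning
  vertical horizontal : ℕ → List (Vec ℕ (suc m))
  vertical b = if a ≡ᵇ b then map (b ∷_) (nbhd n v) else []
  horizontal b = if ∣ a - b ∣ ≡ᵇ 1 then [ b ∷ v ] else []

deg-∷ : ∀ {a} {v : Vec ℕ m} → IsVertex n v → 1 ≤ a → a ≤ n → deg n (a ∷ v) ≡ pathDeg n a + deg n v
deg-∷ {m} {n} {a} {v} v-vertex 1≤a a≤n = begin
  length (nbhd n (a ∷ v))
    ≡⟨ ↭.↭-length (nbhd-∷-↭ v-vertex 1≤a a≤n) ⟩
  length (map (a ∷_) (nbhd n v) ++ map (_∷ v) (pathNbrs n a))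
    ≡⟨ List.length-++ (map (a ∷_) (nbhd n v)) ⟩
  length (map (a ∷_) (nbhd n v)) + length (map (_∷ v) (pathNbrs n a))
    ≡⟨ cong₂ _+_ (List.length-map (a ∷_) (nbhd n v)) (List.length-map (_∷ v) (pathNbrs n a)) ⟩
  deg n v + pathDeg n a
    ≡⟨ ℕ.+-comm (deg n v) (pathDeg n a) ⟩
  pathDeg n a + deg n v ∎
  where open ≡-Reasoning

-- The leverage of a vertex

endCount nearEndCount : ℕ → Vec ℕ m → ℕ
endCount n = countᵇ (isEnd n)
nearEndCount n = countᵇ (isNearEnd n)

sumℚ-nbhd-∷ : ∀ {a} {v : Vec ℕ m} → IsVertex n v → 1 ≤ a → a ≤ n →
  ∀ (F : Vec ℕ (suc m) → ℚ) →
  sumℚ (map F (nbhd n (a ∷ v)))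
    ≡ sumℚ (map (F ∘ (a ∷_)) (nbhd n v)) +ℚ sumℚ (map (F ∘ (_∷ v)) (pathNbrs n a))
sumℚ-nbhd-∷ {n = n} {a} {v} v-vertex 1≤a a≤n F = begin
  sumℚ (map F (nbhd n (a ∷ v)))
    ≡⟨ sumℚ-↭ (↭.map⁺ F (nbhd-∷-↭ v-vertex 1≤a a≤n)) ⟩
  sumℚ (map F (map (a ∷_) (nbhd n v) ++ map (_∷ v) (pathNbrs n a)))
    ≡⟨ cong sumℚ (List.map-++ F (map (a ∷_) (nbhd n v)) _) ⟩
  sumℚ (map F (map (a ∷_) (nbhd n v)) ++ map F (map (_∷ v) (pathNbrs n a)))
    ≡⟨ sumℚ-++ (map F (map (a ∷_) (nbhd n v))) _ ⟩
  sumℚ (map F (map (a ∷_) (nbhd n v))) +ℚ sumℚ (map F (map (_∷ v) (pathNbrs n a)))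
    ≡⟨ cong₂ (λ xs ys → sumℚ xs +ℚ sumℚ ys) (List.map-∘ (nbhd n v)) (List.map-∘ (pathNbrs n a)) ⟨
  sumℚ (map (F ∘ (a ∷_)) (nbhd n v)) +ℚ sumℚ (map (F ∘ (_∷ v)) (pathNbrs n a)) ∎
  where open ≡-Reasoning

pathContribution-∷ : 4 ≤ n → ∀ {a} {v : Vec ℕ m} → IsVertex n v → 1 ≤ a → a ≤ n → ∀ c →
  sumℚ (map (λ b → leverageTerm (c + deg n (a ∷ v)) (c + deg n (b ∷ v))) (pathNbrs n a))
    ≡ leverageBracket (c + deg n (a ∷ v)) (indicator (isNearEnd n a)) (indicator (isEnd n a))
pathContribution-∷ {n} 4≤n {a} {v} v-vertex 1≤a a≤n c = begin
  sumℚ (map (λ b → leverageTerm D (c + deg n (b ∷ v))) (pathNbrs n a))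
    ≡⟨ cong sumℚ (List.map-cong-local
         (All.map (λ (1≤b , b≤n) → cong₂ leverageTerm (rotate 1≤a a≤n) (rotate 1≤b b≤n)) (pathNbrs-inRange n a))) ⟩
  sumℚ (map (λ b → leverageTerm ((c + deg n v) + pathDeg n a) ((c + deg n v) + pathDeg n b)) (pathNbrs n a))
    ≡⟨ pathContribution (pathPosition 4≤n 1≤a a≤n) (c + deg n v) ⟩
  leverageBracket ((c + deg n v) + pathDeg n a) nearEndₐ endₐ
    ≡⟨ cong (λ d → leverageBracket d nearEndₐ endₐ) (rotate 1≤a a≤n) ⟨
  leverageBracket D nearEndₐ endₐ ∎
  where
  open ≡-Reasoning
  D nearEndₐ endₐ : ℕ
  D = c + deg n (a ∷ v)
  nearEndₐ = indicator (isNearEnd n a)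
  endₐ = indicator (isEnd n a)
  rotate : ∀ {b} → 1 ≤ b → b ≤ n → c + deg n (b ∷ v) ≡ (c + deg n v) + pathDeg n b
  rotate {b} 1≤b b≤n = begin
    c + deg n (b ∷ v)            ≡⟨ cong (_+_ c) (deg-∷ v-vertex 1≤b b≤n) ⟩
    c + (pathDeg n b + deg n v)  ≡⟨ cong (_+_ c) (ℕ.+-comm (pathDeg n b) (deg n v)) ⟩
    c + (deg n v + pathDeg n b)  ≡⟨ ℕ.+-assoc c (deg n v) (pathDeg n b) ⟨
    (c + deg n v) + pathDeg n b  ∎

-- The offset c is the degree contributed by coordinates outside v, so that c + deg n w is the
-- degree of the corresponding neighbour in a larger product.
leverageSum : 4 ≤ n → ∀ {v : Vec ℕ m} → IsVertex n v → ∀ c →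
  sumℚ (map (λ w → leverageTerm (c + deg n v) (c + deg n w)) (nbhd n v))
    ≡ leverageBracket (c + deg n v) (nearEndCount n v) (endCount n v)
leverageSum 4≤n Vec.[] c = sym (leverageBracket-zero (c + 0))
leverageSum {n} {suc m} 4≤n {a ∷ v} ((1≤a , a≤n) Vec.∷ v-vertex) c = begin
  sumℚ (map F (nbhd n (a ∷ v)))
    ≡⟨ sumℚ-nbhd-∷ v-vertex 1≤a a≤n F ⟩
  sumℚ (map (F ∘ (a ∷_)) (nbhd n v)) +ℚ sumℚ (map (F ∘ (_∷ v)) (pathNbrs n a))
    ≡⟨ cong₂ _+ℚ_ vertical (pathContribution-∷ 4≤n v-vertex 1≤a a≤n c) ⟩
  leverageBracket D (nearEndCount n v) (endCount n v) +ℚ leverageBracket D nearEndₐ endₐ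
    ≡⟨ leverageBracket-+ D _ _ nearEndₐ endₐ ⟩
  leverageBracket D (nearEndCount n v + nearEndₐ) (endCount n v + endₐ)
    ≡⟨ cong₂ (leverageBracket D) (trans (ℕ.+-comm (nearEndCount n v) _) (sym (countᵇ-∷ (isNearEnd n) a v)))
                                 (trans (ℕ.+-comm (endCount n v) _) (sym (countᵇ-∷ (isEnd n) a v))) ⟩
  leverageBracket D (nearEndCount n (a ∷ v)) (endCount n (a ∷ v)) ∎
  where
  open ≡-Reasoning
  D nearEndₐ endₐ : ℕ
  D = c + deg n (a ∷ v)
  nearEndₐ = indicator (isNearEnd n a)
  endₐ = indicator (isEnd n a)
  F : Vec ℕ (suc m) → ℚ
  F w = leverageTerm D (c + deg n w)
  shift : ∀ {w : Vec ℕ m} → IsVertex n w → c + deg n (a ∷ w) ≡ (c + pathDeg n a) + deg n w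
  shift w-vertex = trans (cong (_+_ c) (deg-∷ w-vertex 1≤a a≤n)) (sym (ℕ.+-assoc c _ _))
  vertical : sumℚ (map (F ∘ (a ∷_)) (nbhd n v)) ≡ leverageBracket D (nearEndCount n v) (endCount n v)
  vertical = begin
    sumℚ (map (F ∘ (a ∷_)) (nbhd n v))
      ≡⟨ cong sumℚ (List.map-cong-local
           (All.map (cong₂ leverageTerm (shift v-vertex) ∘ shift) (nbhd-IsVertex v))) ⟩
    sumℚ (map (λ w → leverageTerm ((c + pathDeg n a) + deg n v) ((c + pathDeg n a) + deg n w)) (nbhd n v))
      ≡⟨ leverageSum 4≤n v-vertex (c + pathDeg n a) ⟩
    leverageBracket ((c + pathDeg n a) + deg n v) (nearEndCount n v) (endCount n v)
      ≡⟨ cong (λ d → leverageBracket d (nearEndCount n v) (endCount n v)) (shift v-vertex) ⟨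
    leverageBracket D (nearEndCount n v) (endCount n v) ∎

lev-formula : 4 ≤ n → ∀ {v : Vec ℕ m} → IsVertex n v →
  lev n v ≡ frac (+ 1) (deg n v) *ℚ leverageBracket (deg n v) (nearEndCount n v) (endCount n v)
lev-formula {n} 4≤n {v} v-vertex = cong (frac (+ 1) (deg n v) *ℚ_) (leverageSum 4≤n v-vertex 0)

deg-+-endCount : 4 ≤ n → ∀ {v : Vec ℕ m} → IsVertex n v → deg n v + endCount n v ≡ m + m
deg-+-endCount 4≤n Vec.[] = refl
deg-+-endCount {n} {suc m} 4≤n {a ∷ v} ((1≤a , a≤n) Vec.∷ v-vertex) = begin
  deg n (a ∷ v) + endCount n (a ∷ v)
    ≡⟨ cong₂ _+_ (deg-∷ v-vertex 1≤a a≤n) (countᵇ-∷ (isEnd n) a v) ⟩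
  (pathDeg n a + deg n v) + (indicator (isEnd n a) + endCount n v)
    ≡⟨ +-interchange (pathDeg n a) (deg n v) _ _ ⟩
  (pathDeg n a + indicator (isEnd n a)) + (deg n v + endCount n v)
    ≡⟨ cong₂ _+_ (pathDeg-+-isEnd (pathPosition 4≤n 1≤a a≤n)) (deg-+-endCount 4≤n v-vertex) ⟩
  2 + (m + m)
    ≡⟨ cong suc (ℕ.+-suc m m) ⟨
  suc m + suc m ∎
  where open ≡-Reasoning

endCount-+-nearEndCount≤ : 4 ≤ n → ∀ {v : Vec ℕ m} → IsVertex n v → endCount n v + nearEndCount n v ≤ m
endCount-+-nearEndCount≤ 4≤n Vec.[] = z≤n
endCount-+-nearEndCount≤ {n} 4≤n {a ∷ v} ((1≤a , a≤n) Vec.∷ v-vertex) = begin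
  endCount n (a ∷ v) + nearEndCount n (a ∷ v)
    ≡⟨ cong₂ _+_ (countᵇ-∷ (isEnd n) a v) (countᵇ-∷ (isNearEnd n) a v) ⟩
  (indicator (isEnd n a) + endCount n v) + (indicator (isNearEnd n a) + nearEndCount n v)
    ≡⟨ +-interchange (indicator (isEnd n a)) _ _ _ ⟩
  (indicator (isEnd n a) + indicator (isNearEnd n a)) + (endCount n v + nearEndCount n v)
    ≤⟨ ℕ.+-mono-≤ (isEnd-+-isNearEnd≤1 (pathPosition 4≤n 1≤a a≤n))
                  (endCount-+-nearEndCount≤ 4≤n v-vertex) ⟩
  suc _ ∎
  where open ℕ.≤-Reasoning

leverageFormula : ℕ → ℕ → ℕ → ℚ
leverageFormula m j i = frac (+ 1) (m + j) *ℚ leverageBracket (m + j) (j ∸ i) (m ∸ j)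

lev-≡-leverageFormula : 4 ≤ n → ∀ {v : Vec ℕ m} → IsVertex n v → ∀ {j i} → j ≤ m →
  endCount n v ≡ m ∸ j → nearEndCount n v ≡ j ∸ i → lev n v ≡ leverageFormula m j i
lev-≡-leverageFormula {n} {m} 4≤n {v} v-vertex {j} {i} j≤m ends nearEnds = begin
  lev n v
    ≡⟨ lev-formula 4≤n v-vertex ⟩
  frac (+ 1) (deg n v) *ℚ leverageBracket (deg n v) (nearEndCount n v) (endCount n v)
    ≡⟨ cong (λ d → frac (+ 1) d *ℚ leverageBracket d (nearEndCount n v) (endCount n v)) deg≡m+j ⟩
  frac (+ 1) (m + j) *ℚ leverageBracket (m + j) (nearEndCount n v) (endCount n v)
    ≡⟨ cong₂ (λ p q → frac (+ 1) (m + j) *ℚ leverageBracket (m + j) p q) nearEnds ends ⟩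
  leverageFormula m j i ∎
  where
  open ≡-Reasoning
  deg≡m+j : deg n v ≡ m + j
  deg≡m+j = ℕ.+-cancelʳ-≡ (m ∸ j) (deg n v) (m + j) (begin
    deg n v + (m ∸ j)        ≡⟨ cong (_+_ (deg n v)) ends ⟨
    deg n v + endCount n v   ≡⟨ deg-+-endCount 4≤n v-vertex ⟩
    m + m                    ≡⟨ cong (_+_ m) (ℕ.m+[n∸m]≡n j≤m) ⟨
    m + (j + (m ∸ j))        ≡⟨ ℕ.+-assoc m j (m ∸ j) ⟨
    (m + j) + (m ∸ j)        ∎)

-- vr m j i is block m (m ∸ j) (m ∸ i) by definition.
block : (m p q : ℕ) → Vec ℕ m
block m p q = tabulate (λ (k : Fin m) → if toℕ k <ᵇ p then 1 else if toℕ k <ᵇ q then 2 else 3)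

block-IsVertex : ∀ k m p q → IsVertex (5 + k) (block m p q)
block-IsVertex k zero p q = Vec.[]
block-IsVertex k (suc m) zero zero = (s≤s z≤n , s≤s (s≤s (s≤s z≤n))) Vec.∷ block-IsVertex k m 0 0
block-IsVertex k (suc m) zero (suc q) = (s≤s z≤n , s≤s (s≤s z≤n)) Vec.∷ block-IsVertex k m 0 q
block-IsVertex k (suc m) (suc p) zero = (s≤s z≤n , s≤s z≤n) Vec.∷ block-IsVertex k m p 0
block-IsVertex k (suc m) (suc p) (suc q) = (s≤s z≤n , s≤s z≤n) Vec.∷ block-IsVertex k m p q

endCount-block : ∀ k m p q → p ≤ q → q ≤ m → endCount (5 + k) (block m p q) ≡ p
endCount-block k zero zero zero z≤n z≤n = refl
endCount-block k (suc m) zero zero z≤n z≤n = endCount-block k m 0 0 z≤n z≤n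
endCount-block k (suc m) zero (suc q) z≤n (s≤s q≤m) = endCount-block k m 0 q z≤n q≤m
endCount-block k (suc m) (suc p) (suc q) (s≤s p≤q) (s≤s q≤m) = cong suc (endCount-block k m p q p≤q q≤m)

nearEndCount-block : ∀ k m p q → p ≤ q → q ≤ m → nearEndCount (5 + k) (block m p q) ≡ q ∸ p
nearEndCount-block k zero zero zero z≤n z≤n = refl
nearEndCount-block k (suc m) zero zero z≤n z≤n = nearEndCount-block k m 0 0 z≤n z≤n
nearEndCount-block k (suc m) zero (suc q) z≤n (s≤s q≤m) = cong suc (nearEndCount-block k m 0 q z≤n q≤m)
nearEndCount-block k (suc m) (suc p) (suc q) (s≤s p≤q) (s≤s q≤m) = nearEndCount-block k m p q p≤q q≤m

[m∸n]∸[m∸o]≡o∸n : ∀ m n o → n ≤ o → o ≤ m → (m ∸ n) ∸ (m ∸ o) ≡ o ∸ n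
[m∸n]∸[m∸o]≡o∸n m zero o z≤n o≤m = ℕ.m∸[m∸n]≡n o≤m
[m∸n]∸[m∸o]≡o∸n (suc m) (suc n) (suc o) (s≤s n≤o) (s≤s o≤m) =
  [m∸n]∸[m∸o]≡o∸n m n o n≤o o≤m

lev-vr : 5 ≤ n → ∀ {m j i} → j ≤ m → i ≤ j → lev n (vr m j i) ≡ leverageFormula m j i
lev-vr {suc (suc (suc (suc (suc k))))} (s≤s (s≤s (s≤s (s≤s (s≤s z≤n))))) {m} {j} {i} j≤m i≤j =
  lev-≡-leverageFormula (s≤s (s≤s (s≤s (s≤s z≤n)))) (block-IsVertex k m (m ∸ j) (m ∸ i)) {j} {i} j≤m
    (endCount-block k m (m ∸ j) (m ∸ i) m∸j≤m∸i (ℕ.m∸n≤m m i))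
    (trans (nearEndCount-block k m (m ∸ j) (m ∸ i) m∸j≤m∸i (ℕ.m∸n≤m m i))
           ([m∸n]∸[m∸o]≡o∸n m i j i≤j j≤m))
  where
  m∸j≤m∸i : m ∸ j ≤ m ∸ i
  m∸j≤m∸i = ℕ.∸-monoʳ-≤ m i≤j

column : ℕ → List (ℕ × ℕ)
column j = map (j ,_) (upTo (suc j))

length-column : ∀ j → length (column j) ≡ suc j
length-column j = trans (List.length-map _ (upTo (suc j))) (List.length-upTo (suc j))

triangle : ℕ → List (ℕ × ℕ)
triangle zero = column 0
triangle (suc m) = triangle m ++ column (suc m)

∈-triangle⁺ : ∀ {m j i} → j ≤ m → i ≤ j → (j , i) ∈ triangle m
∈-triangle⁺ {zero} z≤n z≤n = here refl
∈-triangle⁺ {suc m} j≤1+m i≤j with ℕ.m≤n⇒m<n∨m≡n j≤1+m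
... | inj₁ j<1+m = ∈-++⁺ˡ (∈-triangle⁺ (ℕ.≤-pred j<1+m) i≤j)
... | inj₂ refl = ∈-++⁺ʳ (triangle m) (∈-map⁺ (suc m ,_) (∈-upTo⁺ (s≤s i≤j)))

∈-triangle⁻ : ∀ m {j i} → (j , i) ∈ triangle m → j ≤ m × i ≤ j
∈-triangle⁻ zero (here refl) = z≤n , z≤n
∈-triangle⁻ (suc m) ji∈ with ∈-++⁻ (triangle m) ji∈
... | inj₁ ji∈triangle = map₁ ℕ.m≤n⇒m≤1+n (∈-triangle⁻ m ji∈triangle)
... | inj₂ ji∈column with _ , i∈ , refl ← ∈-map⁻ (suc m ,_) ji∈column =
  ℕ.≤-refl , ℕ.≤-pred (∈-upTo⁻ i∈)

length-triangle : ∀ m → length (triangle m) ≡ (m + 2) C 2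
length-triangle zero = refl
length-triangle (suc m) = begin
  length (triangle m ++ column (suc m))
    ≡⟨ List.length-++ (triangle m) ⟩
  length (triangle m) + length (column (suc m))
    ≡⟨ cong₂ _+_ (length-triangle m) (length-column (suc m)) ⟩
  (m + 2) C 2 + (2 + m)
    ≡⟨ ℕ.+-comm ((m + 2) C 2) (2 + m) ⟩
  (2 + m) + (m + 2) C 2
    ≡⟨ cong (_+ (m + 2) C 2) (trans (ℕ.+-comm 2 m) (sym (nC1≡n (m + 2)))) ⟩
  (m + 2) C 1 + (m + 2) C 2
    ≡⟨ nCk+nC[k+1]≡[n+1]C[k+1] (m + 2) 1 ⟩
  (suc m + 2) C 2 ∎
  where open ≡-Reasoning

leverageValues : ℕ → List ℚ
leverageValues m = map (uncurry (leverageFormula m)) (triangle m)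

length-leverageValues : ∀ m → length (leverageValues m) ≡ (m + 2) C 2
length-leverageValues m = trans (List.length-map _ (triangle m)) (length-triangle m)

levValues⊆leverageValues : 4 ≤ n → map (lev n) (vertices n m) ⊆ leverageValues m
levValues⊆leverageValues {n} {m} 4≤n x∈
  with v , v∈ , refl ← ∈-map⁻ (lev n) x∈ = subst (_∈ leverageValues m) (sym lev≡)
    (∈-map⁺ (uncurry (leverageFormula m)) (∈-triangle⁺ (ℕ.m∸n≤m m ends) (ℕ.m∸n≤m (m ∸ ends) nearEnds)))
  where
  v-vertex : IsVertex n v
  v-vertex = ∈-vertices⁻ v∈
  ends nearEnds : ℕ
  ends = endCount n v
  nearEnds = nearEndCount n v
  ends+nearEnds≤m : ends + nearEnds ≤ m
  ends+nearEnds≤m = endCount-+-nearEndCount≤ 4≤n v-vertex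
  nearEnds≤m∸ends : nearEnds ≤ m ∸ ends
  nearEnds≤m∸ends = ℕ.m+n≤o⇒m≤o∸n nearEnds (subst (_≤ m) (ℕ.+-comm ends nearEnds) ends+nearEnds≤m)
  lev≡ : lev n v ≡ leverageFormula m (m ∸ ends) ((m ∸ ends) ∸ nearEnds)
  lev≡ = lev-≡-leverageFormula 4≤n v-vertex {m ∸ ends} {(m ∸ ends) ∸ nearEnds} (ℕ.m∸n≤m m ends)
    (sym (ℕ.m∸[m∸n]≡n (ℕ.m+n≤o⇒m≤o ends ends+nearEnds≤m)))
    (sym (ℕ.m∸[m∸n]≡n nearEnds≤m∸ends))

leverageValues⊆levValues : 5 ≤ n → leverageValues m ⊆ map (lev n) (vertices n m)
leverageValues⊆levValues {n@(suc (suc (suc (suc (suc k)))))} {m} 5≤n@(s≤s (s≤s (s≤s (s≤s (s≤s z≤n))))) x∈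
  with (j , i) , ji∈ , refl ← ∈-map⁻ (uncurry (leverageFormula m)) x∈
  with j≤m , i≤j ← ∈-triangle⁻ m ji∈ =
  subst (_∈ map (lev n) (vertices n m)) (lev-vr 5≤n j≤m i≤j)
    (∈-map⁺ (lev n) (∈-vertices⁺ (block-IsVertex k m (m ∸ j) (m ∸ i))))

leverageValues-Unique : ∀ m → m < 7 → Unique (leverageValues m)
leverageValues-Unique m m<7 =
  All.lookup (toWitness {a? = All.all? (unique? ∘ leverageValues) (upTo 7)} _) (∈-upTo⁺ m<7)

mainTheorem11 : (m n : ℕ) → 1 ≤ m → 5 ≤ n →
    ((j i : ℕ) → j ≤ m → i ≤ j →
      lev n (vr m j i) ≡ frac (+ 1) (m + j) *ℚ
        (frac (+ (j ∸ i)) (2 * (m + j) ∸ 1) - frac (+ (m ∸ j)) (2 * (m + j) + 1)))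
    × (numLevValues n m ≤ (m + 2) C 2)
    × (m < 7 → numLevValues n m ≡ (m + 2) C 2)
mainTheorem11 m n _ 5≤n = (λ j i → lev-vr 5≤n) , upper , λ m<7 → ℕ.≤-antisym upper (lower m<7)
  where
  levValues : List ℚ
  levValues = map (lev n) (vertices n m)
  upper : numLevValues n m ≤ (m + 2) C 2
  upper = subst (numLevValues n m ≤_) (length-leverageValues m)
    (Unique-⊆⇒length≤ (deduplicate-! levValues)
      (levValues⊆leverageValues {m = m} (ℕ.<⇒≤ 5≤n) ∘ ∈-deduplicate⁻ ℚ._≟_ levValues))
  lower : m < 7 → (m + 2) C 2 ≤ numLevValues n m
  lower m<7 = subst (_≤ numLevValues n m) (length-leverageValues m)
    (Unique-⊆⇒length≤ (leverageValues-Unique m m<7)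
      (∈-deduplicate⁺ ℚ._≟_ ∘ leverageValues⊆levValues {m = m} 5≤n))
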